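{- Let $\ell$ be an odd prime. There are exactly $\ell$ nonabelian subgroups of $\overline{\mathsf{S}}_\ell$ of order $\ell^3$, namely the subgroups $\langle x_1x_2^k,\,x_3\rangle$ for $k=0,\dots,\ell-1$.
   Context: $\overline{\mathsf{S}}_\ell$ is the group of $4\times4$ matrices over $\mathbf{F}_\ell$ that are lower triangular with all diagonal entries $1$ and lie in $\operatorname{Sp}_4(\mathbf{F}_\ell)$, where $\operatorname{Sp}_4(\mathbf{F}_\ell)$ is the group preserving the alternating form on $\mathbf{F}_\ell^4$ with $\langle e_1,e_4\rangle=\langle e_2,e_3\rangle=1$ and $\langle e_1,e_2\rangle=\langle e_1,e_3\rangle=\langle e_4,e_2\rangle=\langle e_4,e_3\rangle=0$ (it has order $\ell^4$). Define $x_1=\begin{pmatrix}1&0&0&0\\1&1&0&0\\0&0&1&0\\0&0&-1&1\end{pmatrix}$, $x_2=\begin{pmatrix}1&0&0&0\\0&1&0&0\\0&1&1&0\\0&0&0&1\end{pmatrix}$, $x_3=\begin{pmatrix}1&0&0&0\\0&1&0&0\\1&0&1&0\\0&1&0&1\end{pmatrix}$. -}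

module Defs where

open import Data.Nat using (ℕ; zero; suc; NonZero) renaming (_+_ to _+ℕ_; _*_ to _*ℕ_; _∸_ to _∸ℕ_)
open import Data.Nat.DivMod using (_mod_)
open import Data.Fin using (Fin; toℕ; zero; suc; _<_; _≟_)
open import Data.Bool using (if_then_else_)
open import Relation.Nullary using (does)
open import Data.Vec using (Vec; tabulate; lookup)
open import Data.Bool using (Bool; T)
open import Data.Product using (Σ; _×_; _,_)
open import Relation.Binary.PropositionalEquality using (_≡_)
open import Relation.Nullary using (¬_)
open import Function.Bundles using (_↔_)

Mat : ℕ → Set
Mat ℓ = Vec (Vec (Fin ℓ) 4) 4

Subset : ℕ → Set
Subset ℓ = Mat ℓ → Bool

module _ {ℓ : ℕ} .{{_ : NonZero ℓ}} where

  0F 1F : Fin ℓ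
  0F = 0 mod ℓ
  1F = 1 mod ℓ

  _+F_ _*F_ : Fin ℓ → Fin ℓ → Fin ℓ
  a +F b = (toℕ a +ℕ toℕ b) mod ℓ
  a *F b = (toℕ a *ℕ toℕ b) mod ℓ

  -F_ : Fin ℓ → Fin ℓ
  -F a = (ℓ ∸ℕ toℕ a) mod ℓ

  _!_!_ : Mat ℓ → Fin 4 → Fin 4 → Fin ℓ
  M ! i ! j = lookup (lookup M i) j

  mat : (Fin 4 → Fin 4 → Fin ℓ) → Mat ℓ
  mat f = tabulate λ i → tabulate λ j → f i j

  _·_ : Mat ℓ → Mat ℓ → Mat ℓ
  A · B = mat λ i j →
    (((A ! i ! zero) *F (B ! zero ! j)) +F ((A ! i ! suc zero) *F (B ! suc zero ! j)))
    +F (((A ! i ! suc (suc zero)) *F (B ! suc (suc zero) ! j))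
       +F ((A ! i ! suc (suc (suc zero))) *F (B ! suc (suc (suc zero)) ! j)))

  transpose : Mat ℓ → Mat ℓ
  transpose M = mat λ i j → M ! j ! i

  I : Mat ℓ
  I = mat δ
    where
    δ : Fin 4 → Fin 4 → Fin ℓ
    δ i j = if does (i ≟ j) then 1F else 0F

  -- Gram matrix of the alternating form: J i j = ⟨e_(i+1), e_(j+1)⟩ with
  -- ⟨e1,e4⟩ = ⟨e2,e3⟩ = 1, ⟨e4,e1⟩ = ⟨e3,e2⟩ = -1, all other pairings 0.
  J : Mat ℓ
  J = mat j
    where
    j : Fin 4 → Fin 4 → Fin ℓ
    j zero (suc (suc (suc zero))) = 1F
    j (suc zero) (suc (suc zero)) = 1F
    j (suc (suc zero)) (suc zero) = -F 1F
    j (suc (suc (suc zero))) zero = -F 1F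
    j _ _ = 0F

  InSp4 : Mat ℓ → Set
  InSp4 M = (transpose M · J) · M ≡ J

  LowerUnitriangular : Mat ℓ → Set
  LowerUnitriangular M = (∀ i j → i < j → M ! i ! j ≡ 0F) × (∀ i → M ! i ! i ≡ 1F)

  InSbar : Mat ℓ → Set
  InSbar M = LowerUnitriangular M × InSp4 M

  IsSubgroup : Subset ℓ → Set
  IsSubgroup H =
    (∀ g → T (H g) → InSbar g) ×
    T (H I) ×
    (∀ g h → T (H g) → T (H h) → T (H (g · h))) ×
    (∀ g → T (H g) → Σ (Mat ℓ) λ h → T (H h) × (g · h ≡ I) × (h · g ≡ I))

  HasOrder : Subset ℓ → ℕ → Set
  HasOrder H n = Fin n ↔ Σ (Mat ℓ) (λ g → T (H g))

  IsAbelian : Subset ℓ → Set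
  IsAbelian H = ∀ g h → T (H g) → T (H h) → g · h ≡ h · g

  Nonabelian : Subset ℓ → Set
  Nonabelian H = ¬ IsAbelian H

  IsGeneratedBy : Subset ℓ → Mat ℓ → Mat ℓ → Set
  IsGeneratedBy H a b =
    IsSubgroup H × T (H a) × T (H b) ×
    (∀ K → IsSubgroup K → T (K a) → T (K b) → ∀ g → T (H g) → T (K g))

  _≐_ : Subset ℓ → Subset ℓ → Set
  H ≐ K = ∀ g → H g ≡ K g

  _^ᴹ_ : Mat ℓ → ℕ → Mat ℓ
  M ^ᴹ zero = I
  M ^ᴹ suc n = M · (M ^ᴹ n)

  x₁ x₂ x₃ : Mat ℓ
  x₁ = mat f
    where
    f : Fin 4 → Fin 4 → Fin ℓ
    f zero zero = 1F
    f (suc zero) zero = 1F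
    f (suc zero) (suc zero) = 1F
    f (suc (suc zero)) (suc (suc zero)) = 1F
    f (suc (suc (suc zero))) (suc (suc zero)) = -F 1F
    f (suc (suc (suc zero))) (suc (suc (suc zero))) = 1F
    f _ _ = 0F
  x₂ = mat f
    where
    f : Fin 4 → Fin 4 → Fin ℓ
    f zero zero = 1F
    f (suc zero) (suc zero) = 1F
    f (suc (suc zero)) (suc zero) = 1F
    f (suc (suc zero)) (suc (suc zero)) = 1F
    f (suc (suc (suc zero))) (suc (suc (suc zero))) = 1F
    f _ _ = 0F
  x₃ = mat f
    where
    f : Fin 4 → Fin 4 → Fin ℓ
    f zero zero = 1F
    f (suc zero) (suc zero) = 1F
    f (suc (suc zero)) zero = 1F
    f (suc (suc zero)) (suc (suc zero)) = 1F
    f (suc (suc (suc zero))) (suc zero) = 1F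
    f (suc (suc (suc zero))) (suc (suc (suc zero))) = 1F
    f _ _ = 0F

module Submission where

-- In the coordinates (a, b, c, d) of S̄_ℓ, q ↦ (a, c) is a homomorphism onto F_ℓ² whose kernel
-- N = {(0, b, 0, d)} is abelian and contains the centre {(0, 0, 0, d)}; x₁x₂ᵏ = (1, 0, k, 0),
-- x₃ = (0, 1, 0, 0), and G_k is the preimage of the line c = k a. A subgroup H with a = 0
-- throughout lies in an abelian subgroup, so a nonabelian H of order ℓ³ has an element h₀ with
-- a₀ ≠ 0; put k = c₀ / a₀. If all of H lies on the line c = k a, then H ⊆ G_k. Otherwise the
-- commutator of h₀ with an element off the line lies in N with b ≠ 0, and its commutator with h₀
-- is central and nonzero because ℓ is odd; the F_ℓ-multiples of these two fill N, and together
-- with h₀ they give G_k ⊆ H. Either way H = G_k, both having ℓ³ elements. The same commutators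
-- show that G_k is generated by x₁x₂ᵏ and x₃ and is not abelian.

open import Defs
open import Data.Nat using (ℕ; NonZero; _^_; _<_)
open import Data.Nat.Divisibility using (_∣_)
open import Data.Nat.Primality using (Prime)
open import Data.Fin using (Fin; toℕ)
open import Data.Product using (Σ; _×_; _,_)
open import Relation.Binary.PropositionalEquality using (_≡_)
open import Relation.Nullary using (¬_)

module Finite where

  open import Data.Bool using (Bool; T; true)
  open import Data.Bool.Properties using (T-irrelevant; T-≡; ⇔→≡)
  open import Data.Empty using (⊥-elim)
  open import Data.Fin using (Fin; punchOut)
  open import Data.Fin.Properties using (any?; injective⇒≤; punchOut-injective; _≟_; *↔×)
  open import Data.Nat using (zero; suc; _^_) renaming (_*_ to _*ℕ_)
  open import Data.Nat.Properties using (1+n≰n; *-identityʳ)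
  open import Data.Product using (Σ; _×_; _,_; proj₁; proj₂)
  open import Data.Product.Function.NonDependent.Propositional using (_×-↔_)
  open import Data.Sum using (_⊎_; inj₁; inj₂)
  open import Function using (_∘_)
  open import Function.Bundles using (_↔_; Inverse; Injection; mk⇔; Equivalence)
  open import Function.Definitions using (Injective; StrictlySurjective)
  open import Function.Properties.Inverse using (↔-refl; ↔-sym; ↔-trans; ↔⇒↣)
  open import Relation.Binary.PropositionalEquality
  open import Relation.Nullary using (¬_; Dec; yes; no; ¬?)
  open import Relation.Nullary.Decidable using (decidable-stable)
  open import Relation.Unary using (Decidable)

  injective⇒strictlySurjective : ∀ {n} {f : Fin n → Fin n} →
    Injective _≡_ _≡_ f → StrictlySurjective _≡_ f
  injective⇒strictlySurjective {zero} _ ()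
  injective⇒strictlySurjective {suc n} {f} f-inj y with any? (λ x → f x ≟ y)
  ... | yes hit = hit
  ... | no miss = ⊥-elim (1+n≰n (injective⇒≤ {f = g} g-inj))
    where
    f≢y : ∀ x → y ≢ f x
    f≢y x eq = miss (x , sym eq)
    g : Fin (suc n) → Fin n
    g x = punchOut (f≢y x)
    g-inj : Injective _≡_ _≡_ g
    g-inj eq = f-inj (punchOut-injective (f≢y _) (f≢y _) eq)

  T-injective : ∀ {x y} → (T x → T y) → (T y → T x) → x ≡ y
  T-injective x⇒y y⇒x = ⇔→≡ {z = true}
    (mk⇔ (to T-≡ ∘ x⇒y ∘ from T-≡) (to T-≡ ∘ y⇒x ∘ from T-≡))
    where open Equivalence

  Fin-*1↔ : ∀ n → Fin (n *ℕ 1) ↔ Fin n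
  Fin-*1↔ n = subst (λ m → Fin m ↔ Fin n) (sym (*-identityʳ n)) ↔-refl

  Fin-^3↔ : ∀ n → Fin (n ^ 3) ↔ (Fin n × Fin n × Fin n)
  Fin-^3↔ n = ↔-trans (*↔× {n}) (↔-refl ×-↔ (↔-trans (*↔× {n}) (↔-refl ×-↔ Fin-*1↔ n)))

  module _ {X : Set} where

    Elements : (X → Bool) → Set
    Elements A = Σ X (T ∘ A)

    element-≡ : ∀ {A} {p q : Elements A} → proj₁ p ≡ proj₁ q → p ≡ q
    element-≡ {p = x , px} {q = .x , qx} refl = cong (x ,_) (T-irrelevant px qx)

    module _ {n} {A B : X → Bool} (A↔ : Fin n ↔ Elements A) (B↔ : Fin n ↔ Elements B) where

      ⊆-of-equal-size⇒⊇ : (∀ x → T (A x) → T (B x)) → ∀ x → T (B x) → T (A x)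
      ⊆-of-equal-size⇒⊇ A⊆B x xB = found (injective⇒strictlySurjective f-injective (from B↔ (x , xB)))
        where
        open Inverse
        include : Elements A → Elements B
        include (y , yA) = y , A⊆B y yA
        from-B-injective : Injective _≡_ _≡_ (from B↔)
        from-B-injective = Injection.injective (↔⇒↣ (↔-sym B↔))
        f : Fin n → Fin n
        f = from B↔ ∘ include ∘ to A↔
        f-injective : Injective _≡_ _≡_ f
        f-injective eq = Injection.injective (↔⇒↣ A↔) (element-≡ (cong proj₁ (from-B-injective eq)))
        found : (Σ (Fin n) λ i → f i ≡ from B↔ (x , xB)) → T (A x)
        found (i , fi≡x) = subst (T ∘ A) (cong proj₁ (from-B-injective fi≡x)) (proj₂ (to A↔ i))

    all-or-counterexample : ∀ {n} {A : X → Bool} (P : X → Set) → Decidable P →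
      Fin n ↔ Elements A → (Σ X λ x → T (A x) × ¬ P x) ⊎ (∀ x → T (A x) → P x)
    all-or-counterexample {n} {A} P P? A↔ = decide (any? λ i → ¬? (P? (proj₁ (to i))))
      where
      open Inverse A↔
      decide : Dec (Σ (Fin n) λ i → ¬ P (proj₁ (to i))) → (Σ X λ x → T (A x) × ¬ P x) ⊎ (∀ x → T (A x) → P x)
      decide (yes (i , ¬Px)) = inj₁ (proj₁ (to i) , proj₂ (to i) , ¬Px)
      decide (no none) = inj₂ λ x xA → decidable-stable (P? x) λ ¬Px →
        none (from (x , xA) , subst (¬_ ∘ P ∘ proj₁) (sym (strictlyInverseˡ (x , xA))) ¬Px)

module ZMod where

  open Finite using (injective⇒strictlySurjective)
  open import Algebra.Bundles using (CommutativeRing)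
  import Algebra.Properties.Ring as RingProperties
  import Algebra.Solver.Ring as RingSolver
  open import Algebra.Solver.Ring.AlmostCommutativeRing using (fromCommutativeRing; _-Raw-AlmostCommutative⟶_)
  open import Data.Empty using (⊥-elim)
  open import Data.Fin using (Fin; toℕ)
  open import Data.Fin.Properties using (toℕ-injective; toℕ-fromℕ<; toℕ<n)
  open import Data.Integer as ℤ using (ℤ; +_; -[1+_])
  import Data.Integer.Properties as ℤ
  open import Data.Maybe using (Maybe; just; nothing)
  open import Data.Nat as ℕ using (ℕ; zero; suc; NonZero; _%_; _<_)
  open import Data.Nat.Base using (nonTrivial⇒n>1)
  open import Data.Nat.DivMod using (_mod_; m%n<n; %-distribˡ-+; %-distribˡ-*; [m+n]%n≡m%n; m<n⇒m%n≡m)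
  open import Data.Nat.Divisibility using (_∣_; ∣-refl; m%n≡0⇒n∣m; n∣m⇒m%n≡0)
  open import Data.Nat.Primality using (Prime; prime⇒nonTrivial; euclidsLemma)
  import Data.Nat.Properties as ℕ
  open import Data.Product using (Σ; _,_)
  open import Data.Sum using (_⊎_; inj₁; inj₂; [_,_]′)
  open import Function using (_∘′_)
  open import Relation.Binary.PropositionalEquality
  open import Relation.Nullary using (¬_; yes; no)

  open ≡-Reasoning

  module _ {ℓ : ℕ} .{{_ : NonZero ℓ}} where

    toℕ-mod : ∀ m → toℕ (m mod ℓ) ≡ m % ℓ
    toℕ-mod m = toℕ-fromℕ< (m%n<n m ℓ)

    mod-toℕ : ∀ (x : Fin ℓ) → toℕ x mod ℓ ≡ x
    mod-toℕ x = toℕ-injective (trans (toℕ-mod (toℕ x)) (m<n⇒m%n≡m (toℕ<n x)))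

    mod-cong : ∀ {m n} → m % ℓ ≡ n % ℓ → m mod ℓ ≡ n mod ℓ
    mod-cong eq = toℕ-injective (trans (toℕ-mod _) (trans eq (sym (toℕ-mod _))))

    mod-+ : ∀ m n → (m ℕ.+ n) mod ℓ ≡ (m mod ℓ) +F (n mod ℓ)
    mod-+ m n = mod-cong (begin
      (m ℕ.+ n) % ℓ                                    ≡⟨ %-distribˡ-+ m n ℓ ⟩
      (m % ℓ ℕ.+ n % ℓ) % ℓ                            ≡⟨ cong₂ (λ s t → (s ℕ.+ t) % ℓ) (toℕ-mod m) (toℕ-mod n) ⟨
      (toℕ (m mod ℓ) ℕ.+ toℕ (n mod ℓ)) % ℓ            ∎)

    mod-* : ∀ m n → (m ℕ.* n) mod ℓ ≡ (m mod ℓ) *F (n mod ℓ)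
    mod-* m n = mod-cong (begin
      (m ℕ.* n) % ℓ                                    ≡⟨ %-distribˡ-* m n ℓ ⟩
      (m % ℓ ℕ.* (n % ℓ)) % ℓ                          ≡⟨ cong₂ (λ s t → (s ℕ.* t) % ℓ) (toℕ-mod m) (toℕ-mod n) ⟨
      (toℕ (m mod ℓ) ℕ.* toℕ (n mod ℓ)) % ℓ            ∎)

    +F-assoc : ∀ x y z → (x +F y) +F z ≡ x +F (y +F z)
    +F-assoc x y z = begin
      (x +F y) +F z                            ≡⟨ cong ((x +F y) +F_) (mod-toℕ z) ⟨
      (x +F y) +F (toℕ z mod ℓ)                ≡⟨ mod-+ (toℕ x ℕ.+ toℕ y) (toℕ z) ⟨
      (toℕ x ℕ.+ toℕ y ℕ.+ toℕ z) mod ℓ        ≡⟨ cong (_mod ℓ) (ℕ.+-assoc (toℕ x) (toℕ y) (toℕ z)) ⟩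
      (toℕ x ℕ.+ (toℕ y ℕ.+ toℕ z)) mod ℓ      ≡⟨ mod-+ (toℕ x) (toℕ y ℕ.+ toℕ z) ⟩
      (toℕ x mod ℓ) +F (y +F z)                ≡⟨ cong (_+F (y +F z)) (mod-toℕ x) ⟩
      x +F (y +F z)                            ∎

    *F-assoc : ∀ x y z → (x *F y) *F z ≡ x *F (y *F z)
    *F-assoc x y z = begin
      (x *F y) *F z                            ≡⟨ cong ((x *F y) *F_) (mod-toℕ z) ⟨
      (x *F y) *F (toℕ z mod ℓ)                ≡⟨ mod-* (toℕ x ℕ.* toℕ y) (toℕ z) ⟨
      (toℕ x ℕ.* toℕ y ℕ.* toℕ z) mod ℓ        ≡⟨ cong (_mod ℓ) (ℕ.*-assoc (toℕ x) (toℕ y) (toℕ z)) ⟩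
      (toℕ x ℕ.* (toℕ y ℕ.* toℕ z)) mod ℓ      ≡⟨ mod-* (toℕ x) (toℕ y ℕ.* toℕ z) ⟩
      (toℕ x mod ℓ) *F (y *F z)                ≡⟨ cong (_*F (y *F z)) (mod-toℕ x) ⟩
      x *F (y *F z)                            ∎

    *F-distribˡ-+F : ∀ x y z → x *F (y +F z) ≡ (x *F y) +F (x *F z)
    *F-distribˡ-+F x y z = begin
      x *F (y +F z)                                   ≡⟨ cong (_*F (y +F z)) (mod-toℕ x) ⟨
      (toℕ x mod ℓ) *F (y +F z)                       ≡⟨ mod-* (toℕ x) (toℕ y ℕ.+ toℕ z) ⟨
      (toℕ x ℕ.* (toℕ y ℕ.+ toℕ z)) mod ℓ             ≡⟨ cong (_mod ℓ) (ℕ.*-distribˡ-+ (toℕ x) (toℕ y) (toℕ z)) ⟩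
      (toℕ x ℕ.* toℕ y ℕ.+ toℕ x ℕ.* toℕ z) mod ℓ     ≡⟨ mod-+ (toℕ x ℕ.* toℕ y) (toℕ x ℕ.* toℕ z) ⟩
      (x *F y) +F (x *F z)                            ∎

    +F-comm : ∀ x y → x +F y ≡ y +F x
    +F-comm x y = cong (_mod ℓ) (ℕ.+-comm (toℕ x) (toℕ y))

    *F-comm : ∀ x y → x *F y ≡ y *F x
    *F-comm x y = cong (_mod ℓ) (ℕ.*-comm (toℕ x) (toℕ y))

    +F-identityˡ : ∀ x → 0F +F x ≡ x
    +F-identityˡ x = begin
      0F +F x                      ≡⟨ cong (0F +F_) (mod-toℕ x) ⟨
      0F +F (toℕ x mod ℓ)          ≡⟨ mod-+ 0 (toℕ x) ⟨
      toℕ x mod ℓ                  ≡⟨ mod-toℕ x ⟩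
      x                            ∎

    *F-identityˡ : ∀ x → 1F *F x ≡ x
    *F-identityˡ x = begin
      1F *F x                      ≡⟨ cong (1F *F_) (mod-toℕ x) ⟨
      1F *F (toℕ x mod ℓ)          ≡⟨ mod-* 1 (toℕ x) ⟨
      (1 ℕ.* toℕ x) mod ℓ          ≡⟨ cong (_mod ℓ) (ℕ.*-identityˡ (toℕ x)) ⟩
      toℕ x mod ℓ                  ≡⟨ mod-toℕ x ⟩
      x                            ∎

    -F-inverseˡ : ∀ x → (-F x) +F x ≡ 0F
    -F-inverseˡ x = begin
      (-F x) +F x                          ≡⟨ cong ((-F x) +F_) (mod-toℕ x) ⟨
      (-F x) +F (toℕ x mod ℓ)              ≡⟨ mod-+ (ℓ ℕ.∸ toℕ x) (toℕ x) ⟨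
      (ℓ ℕ.∸ toℕ x ℕ.+ toℕ x) mod ℓ        ≡⟨ cong (_mod ℓ) (ℕ.m∸n+n≡m (ℕ.<⇒≤ (toℕ<n x))) ⟩
      ℓ mod ℓ                              ≡⟨ mod-cong ([m+n]%n≡m%n 0 ℓ) ⟩
      0F                                   ∎

    +-*-commutativeRing : CommutativeRing _ _
    +-*-commutativeRing = record
      { Carrier = Fin ℓ ; _≈_ = _≡_ ; _+_ = _+F_ ; _*_ = _*F_ ; -_ = -F_ ; 0# = 0F ; 1# = 1F
      ; isCommutativeRing = record
        { isRing = record
          { +-isAbelianGroup = record
            { isGroup = record
              { isMonoid = record
                { isSemigroup = record
                  { isMagma = record { isEquivalence = isEquivalence ; ∙-cong = cong₂ _+F_ }
                  ; assoc = +F-assoc }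
                ; identity = +F-identityˡ , λ x → trans (+F-comm x 0F) (+F-identityˡ x) }
              ; inverse = -F-inverseˡ , λ x → trans (+F-comm x (-F x)) (-F-inverseˡ x)
              ; ⁻¹-cong = cong -F_ }
            ; comm = +F-comm }
          ; *-cong = cong₂ _*F_
          ; *-assoc = *F-assoc
          ; *-identity = *F-identityˡ , λ x → trans (*F-comm x 1F) (*F-identityˡ x)
          ; distrib = *F-distribˡ-+F , λ x y z →
              trans (*F-comm (y +F z) x) (trans (*F-distribˡ-+F x y z) (cong₂ _+F_ (*F-comm x y) (*F-comm x z))) }
        ; *-comm = *F-comm } }

    open RingProperties (CommutativeRing.ring +-*-commutativeRing)
      using (-‿involutive; -‿+-comm; -‿distribˡ-*; -‿distribʳ-*; ⁻¹-anti-homo‿-; -0#≈0#)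

    +F-moveʳ : ∀ x y z → x ≡ y +F z → y ≡ x +F (-F z)
    +F-moveʳ .(y +F z) y z refl = begin
      y                          ≡⟨ +F-identityˡ y ⟨
      0F +F y                    ≡⟨ +F-comm 0F y ⟩
      y +F 0F                    ≡⟨ cong (y +F_) (-F-inverseˡ z) ⟨
      y +F ((-F z) +F z)         ≡⟨ cong (y +F_) (+F-comm (-F z) z) ⟩
      y +F (z +F (-F z))         ≡⟨ +F-assoc y z (-F z) ⟨
      (y +F z) +F (-F z)         ∎

    ⟦_⟧ℤ : ℤ → Fin ℓ
    ⟦ + n ⟧ℤ = n mod ℓ
    ⟦ -[1+ n ] ⟧ℤ = -F (suc n mod ℓ)

    ⟦-⟧ℤ : ∀ i → ⟦ ℤ.- i ⟧ℤ ≡ -F ⟦ i ⟧ℤ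
    ⟦-⟧ℤ (+ zero) = sym -0#≈0#
    ⟦-⟧ℤ (+ suc n) = refl
    ⟦-⟧ℤ -[1+ n ] = sym (-‿involutive _)

    ⟦⊖⟧ℤ : ∀ m n → ⟦ m ℤ.⊖ n ⟧ℤ ≡ (m mod ℓ) +F (-F (n mod ℓ))
    ⟦⊖⟧ℤ m n with ℕ.≤-<-connex n m
    ... | inj₁ n≤m = begin
      ⟦ m ℤ.⊖ n ⟧ℤ                     ≡⟨ cong ⟦_⟧ℤ (ℤ.⊖-≥ n≤m) ⟩
      (m ℕ.∸ n) mod ℓ                  ≡⟨ +F-moveʳ (m mod ℓ) ((m ℕ.∸ n) mod ℓ) (n mod ℓ)
                                            (trans (cong (_mod ℓ) (sym (ℕ.m∸n+n≡m n≤m))) (mod-+ (m ℕ.∸ n) n)) ⟩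
      (m mod ℓ) +F (-F (n mod ℓ))      ∎
    ... | inj₂ m<n = begin
      ⟦ m ℤ.⊖ n ⟧ℤ                     ≡⟨ cong ⟦_⟧ℤ (ℤ.⊖-< m<n) ⟩
      ⟦ ℤ.- (+ (n ℕ.∸ m)) ⟧ℤ           ≡⟨ ⟦-⟧ℤ (+ (n ℕ.∸ m)) ⟩
      -F ((n ℕ.∸ m) mod ℓ)             ≡⟨ cong -F_ (+F-moveʳ (n mod ℓ) ((n ℕ.∸ m) mod ℓ) (m mod ℓ)
                                            (trans (cong (_mod ℓ) (sym (ℕ.m∸n+n≡m (ℕ.<⇒≤ m<n)))) (mod-+ (n ℕ.∸ m) m))) ⟩
      -F ((n mod ℓ) +F (-F (m mod ℓ))) ≡⟨ ⁻¹-anti-homo‿- (n mod ℓ) (m mod ℓ) ⟩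
      (m mod ℓ) +F (-F (n mod ℓ))      ∎

    ⟦+⟧ℤ : ∀ i j → ⟦ i ℤ.+ j ⟧ℤ ≡ ⟦ i ⟧ℤ +F ⟦ j ⟧ℤ
    ⟦+⟧ℤ (+ m) (+ n) = mod-+ m n
    ⟦+⟧ℤ (+ m) -[1+ n ] = ⟦⊖⟧ℤ m (suc n)
    ⟦+⟧ℤ -[1+ m ] (+ n) = trans (⟦⊖⟧ℤ n (suc m)) (+F-comm (n mod ℓ) _)
    ⟦+⟧ℤ -[1+ m ] -[1+ n ] = begin
      -F (suc (suc (m ℕ.+ n)) mod ℓ)              ≡⟨ cong (λ k → -F (k mod ℓ)) (ℕ.+-suc (suc m) n) ⟨
      -F ((suc m ℕ.+ suc n) mod ℓ)                ≡⟨ cong -F_ (mod-+ (suc m) (suc n)) ⟩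
      -F ((suc m mod ℓ) +F (suc n mod ℓ))         ≡⟨ -‿+-comm (suc m mod ℓ) (suc n mod ℓ) ⟨
      (-F (suc m mod ℓ)) +F (-F (suc n mod ℓ))    ∎

    ⟦+*⟧ℤ : ∀ m j → ⟦ + m ℤ.* j ⟧ℤ ≡ (m mod ℓ) *F ⟦ j ⟧ℤ
    ⟦+*⟧ℤ m (+ n) = trans (cong ⟦_⟧ℤ (sym (ℤ.pos-* m n))) (mod-* m n)
    ⟦+*⟧ℤ m -[1+ n ] = begin
      ⟦ + m ℤ.* ℤ.- (+ suc n) ⟧ℤ       ≡⟨ cong ⟦_⟧ℤ (ℤ.neg-distribʳ-* (+ m) (+ suc n)) ⟨
      ⟦ ℤ.- (+ m ℤ.* + suc n) ⟧ℤ       ≡⟨ ⟦-⟧ℤ (+ m ℤ.* + suc n) ⟩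
      -F ⟦ + m ℤ.* + suc n ⟧ℤ          ≡⟨ cong -F_ (⟦+*⟧ℤ m (+ suc n)) ⟩
      -F ((m mod ℓ) *F (suc n mod ℓ))  ≡⟨ -‿distribʳ-* (m mod ℓ) (suc n mod ℓ) ⟩
      (m mod ℓ) *F (-F (suc n mod ℓ))  ∎

    ⟦*⟧ℤ : ∀ i j → ⟦ i ℤ.* j ⟧ℤ ≡ ⟦ i ⟧ℤ *F ⟦ j ⟧ℤ
    ⟦*⟧ℤ (+ m) j = ⟦+*⟧ℤ m j
    ⟦*⟧ℤ -[1+ m ] j = begin
      ⟦ ℤ.- (+ suc m) ℤ.* j ⟧ℤ       ≡⟨ cong ⟦_⟧ℤ (ℤ.neg-distribˡ-* (+ suc m) j) ⟨
      ⟦ ℤ.- (+ suc m ℤ.* j) ⟧ℤ       ≡⟨ ⟦-⟧ℤ (+ suc m ℤ.* j) ⟩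
      -F ⟦ + suc m ℤ.* j ⟧ℤ          ≡⟨ cong -F_ (⟦+*⟧ℤ (suc m) j) ⟩
      -F ((suc m mod ℓ) *F ⟦ j ⟧ℤ)   ≡⟨ -‿distribˡ-* (suc m mod ℓ) ⟦ j ⟧ℤ ⟩
      (-F (suc m mod ℓ)) *F ⟦ j ⟧ℤ   ∎

    ℤ-morphism : CommutativeRing.rawRing ℤ.+-*-commutativeRing
                   -Raw-AlmostCommutative⟶ fromCommutativeRing +-*-commutativeRing
    ℤ-morphism = record
      { ⟦_⟧ = ⟦_⟧ℤ ; +-homo = ⟦+⟧ℤ ; *-homo = ⟦*⟧ℤ ; -‿homo = ⟦-⟧ℤ ; 0-homo = refl ; 1-homo = refl }

    ⟦_⟧ℤ≟_ : ∀ i j → Maybe (⟦ i ⟧ℤ ≡ ⟦ j ⟧ℤ)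
    ⟦ i ⟧ℤ≟ j with i ℤ.≟ j
    ... | yes refl = just refl
    ... | no _ = nothing

    module Solver = RingSolver (CommutativeRing.rawRing ℤ.+-*-commutativeRing)
      (fromCommutativeRing +-*-commutativeRing) ℤ-morphism ⟦_⟧ℤ≟_

    -- Checking `refl` against syntactic normal forms is much cheaper than against their
    -- evaluations, which Agda tends to unfold into modular arithmetic.
    proveN : ∀ {n} (p q : Solver.Polynomial n) ρ → Solver.normalise p ≡ Solver.normalise q →
      Solver.⟦ p ⟧ ρ ≡ Solver.⟦ q ⟧ ρ
    proveN p q ρ eq = Solver.prove ρ p q (cong (λ r → Solver.⟦ r ⟧N ρ) eq)

    open CommutativeRing +-*-commutativeRing public
      using (_+_; _*_; -_; _-_; zeroˡ; zeroʳ; +-identityʳ; *-identityʳ; *-comm; distribˡ)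
    open Solver using (solve; _:=_; _:+_; _:*_; _:-_; :-_; con)

    toℕ-0F : toℕ (0F {ℓ}) ≡ 0
    toℕ-0F = trans (toℕ-mod 0) (m<n⇒m%n≡m (ℕ.>-nonZero⁻¹ ℓ))

    toℕ≡0⇒≡0F : ∀ {x} → toℕ x ≡ 0 → x ≡ 0F
    toℕ≡0⇒≡0F eq = toℕ-injective (trans eq (sym toℕ-0F))

    mod≢0F : ∀ {m} → 0 < m → m < ℓ → m mod ℓ ≢ 0F
    mod≢0F {suc m} _ m<ℓ eq = ℕ.1+n≢0 (begin
      suc m                    ≡⟨ m<n⇒m%n≡m m<ℓ ⟨
      suc m % ℓ                ≡⟨ toℕ-mod (suc m) ⟨
      toℕ (suc m mod ℓ)        ≡⟨ cong toℕ eq ⟩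
      toℕ (0F {ℓ})             ≡⟨ toℕ-0F ⟩
      0                        ∎)

    1F≢0F : 1 < ℓ → 1F ≢ 0F
    1F≢0F = mod≢0F (ℕ.s≤s ℕ.z≤n)

    2F : Fin ℓ
    2F = 1F + 1F

    2F≢0F : 2 < ℓ → 2F ≢ 0F
    2F≢0F 2<ℓ = mod≢0F (ℕ.s≤s ℕ.z≤n) 2<ℓ ∘′ trans (mod-+ 1 1)

    x-y≡0⇒x≡y : ∀ {x y} → x - y ≡ 0F → x ≡ y
    x-y≡0⇒x≡y {x} {y} eq = begin
      x                ≡⟨ solve 2 (λ x y → x := (x :- y) :+ y) refl x y ⟩
      (x - y) + y      ≡⟨ cong (_+ y) eq ⟩
      0F + y           ≡⟨ +F-identityˡ y ⟩
      y                ∎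

    +-closed⇒scalar-closed : (P : Fin ℓ → Fin ℓ → Set) → P 0F 0F →
      (∀ {x y x′ y′} → P x y → P x′ y′ → P (x + x′) (y + y′)) →
      ∀ {x y} → P x y → ∀ s → P (s * x) (s * y)
    +-closed⇒scalar-closed P P00 P+ {x} {y} Pxy s =
      subst₂ P (cong (_* x) (mod-toℕ s)) (cong (_* y) (mod-toℕ s)) (multiples (toℕ s))
      where
      suc-* : ∀ n z → (suc n mod ℓ) * z ≡ z + (n mod ℓ) * z
      suc-* n z = begin
        (suc n mod ℓ) * z               ≡⟨ cong (_* z) (mod-+ 1 n) ⟩
        (1F + (n mod ℓ)) * z            ≡⟨ solve 2 (λ m z → (con (ℤ.+ 1) :+ m) :* z := z :+ m :* z) refl (n mod ℓ) z ⟩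
        z + (n mod ℓ) * z               ∎
      multiples : ∀ n → P ((n mod ℓ) * x) ((n mod ℓ) * y)
      multiples zero = subst₂ P (sym (zeroˡ x)) (sym (zeroˡ y)) P00
      multiples (suc n) = subst₂ P (sym (suc-* n x)) (sym (suc-* n y)) (P+ Pxy (multiples n))

    ℓ∣toℕ⇒≡0F : ∀ {x} → ℓ ∣ toℕ x → x ≡ 0F
    ℓ∣toℕ⇒≡0F {x} ℓ∣x = toℕ≡0⇒≡0F (trans (sym (m<n⇒m%n≡m (toℕ<n x))) (n∣m⇒m%n≡0 (toℕ x) ℓ ℓ∣x))

    module _ (ℓ-prime : Prime ℓ) where

      *F-zero-divisor : ∀ x y → x * y ≡ 0F → x ≡ 0F ⊎ y ≡ 0F
      *F-zero-divisor x y xy≡0 with euclidsLemma (toℕ x) (toℕ y) ℓ-prime ℓ∣xy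
        where
        ℓ∣xy : ℓ ∣ toℕ x ℕ.* toℕ y
        ℓ∣xy = m%n≡0⇒n∣m _ ℓ (trans (sym (toℕ-mod _)) (trans (cong toℕ xy≡0) toℕ-0F))
      ... | inj₁ ℓ∣x = inj₁ (ℓ∣toℕ⇒≡0F ℓ∣x)
      ... | inj₂ ℓ∣y = inj₂ (ℓ∣toℕ⇒≡0F ℓ∣y)

      *F-≢0F : ∀ {x y} → x ≢ 0F → y ≢ 0F → x * y ≢ 0F
      *F-≢0F {x} {y} x≢0 y≢0 xy≡0 with *F-zero-divisor x y xy≡0
      ... | inj₁ x≡0 = x≢0 x≡0
      ... | inj₂ y≡0 = y≢0 y≡0

      *F-cancelʳ-≢0F : ∀ {t} → t ≢ 0F → ∀ u v → u * t ≡ v * t → u ≡ v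
      *F-cancelʳ-≢0F {t} t≢0 u v ut≡vt =
        [ x-y≡0⇒x≡y , (λ t≡0 → ⊥-elim (t≢0 t≡0)) ]′ (*F-zero-divisor (u - v) t [u-v]t≡0)
        where
        [u-v]t≡0 : (u - v) * t ≡ 0F
        [u-v]t≡0 = begin
          (u - v) * t              ≡⟨ solve 3 (λ u v t → (u :- v) :* t := u :* t :- v :* t) refl u v t ⟩
          u * t - v * t            ≡⟨ cong (_- (v * t)) ut≡vt ⟩
          v * t - v * t            ≡⟨ solve 2 (λ v t → v :* t :- v :* t := con (ℤ.+ 0)) refl v t ⟩
          0F                       ∎

      *F-divide : ∀ {t} → t ≢ 0F → ∀ b → Σ (Fin ℓ) λ s → s * t ≡ b
      *F-divide t≢0 = injective⇒strictlySurjective (*F-cancelʳ-≢0F t≢0 _ _)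

  odd-prime⇒2< : ∀ {p} → Prime p → ¬ 2 ∣ p → 2 < p
  odd-prime⇒2< {p} p-prime 2∤p = ℕ.≤∧≢⇒< (nonTrivial⇒n>1 p {{prime⇒nonTrivial p-prime}}) λ { refl → 2∤p ∣-refl }

module Coordinates where

  open ZMod using (+-*-commutativeRing; module Solver; proveN)
  open import Algebra.Bundles using (RawRing; CommutativeRing; Group)
  open import Data.Fin using (Fin; fromℕ; _↑ˡ_)
  open import Data.Integer using (+_)
  open import Data.Nat as ℕ using (ℕ; suc; NonZero)
  open import Data.Product using (_,_)
  open import Data.Vec using (Vec; []; _∷_)
  open import Level using (0ℓ)
  open import Relation.Binary.PropositionalEquality

  record Quad (A : Set) : Set where
    constructor quad
    field α β γ δ : A
  open Quad public

  quad-≡ : ∀ {A} {p q : Quad A} → α p ≡ α q → β p ≡ β q → γ p ≡ γ q → δ p ≡ δ q → p ≡ q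
  quad-≡ refl refl refl refl = refl

  -- Coordinates (a, b, c, d) stand for the matrix with rows 1 0 0 0 / a 1 0 0 / b c 1 0 /
  -- d (b - a c) (- a) 1 (`matrix` below), and _∙_ is the matrix product in these coordinates.
  -- The law is stated over any raw ring so that it can also be evaluated on polynomials.
  module QuadLaw (R : RawRing 0ℓ 0ℓ) where
    open RawRing R

    infixl 7 _∙_
    infix 8 _⁻¹

    _∙_ : Quad Carrier → Quad Carrier → Quad Carrier
    p ∙ q = quad (α p + α q) ((β p + β q) + γ p * α q) (γ p + γ q)
                 (((δ p + δ q) + (β p + - (α p * γ p)) * α q) + - (α p * β q))

    _⁻¹ : Quad Carrier → Quad Carrier
    q ⁻¹ = quad (- α q) (α q * γ q + - β q) (- γ q) (- δ q)

    ε : Quad Carrier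
    ε = quad 0# 0# 0# 0#

    ⁅_,_⁆ : Quad Carrier → Quad Carrier → Quad Carrier
    ⁅ p , q ⁆ = (q ∙ p) ⁻¹ ∙ (p ∙ q)

    kernel : Carrier → Carrier → Quad Carrier
    kernel b d = quad 0# b 0# d

    central : Carrier → Quad Carrier
    central d = kernel 0# d

  module _ {ℓ : ℕ} .{{_ : NonZero ℓ}} where

    open Solver {ℓ} using (Polynomial; Normal; normalise; var; con; _:+_; _:*_; :-_; ⟦_⟧)

    open QuadLaw (CommutativeRing.rawRing (+-*-commutativeRing {ℓ})) public

    polynomialRawRing : ℕ → RawRing 0ℓ 0ℓ
    polynomialRawRing n = record
      { Carrier = Polynomial n ; _≈_ = _≡_ ; _+_ = _:+_ ; _*_ = _:*_ ; -_ = :-_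
      ; 0# = con (+ 0) ; 1# = con (+ 1) }

    module Symbolic {n : ℕ} = QuadLaw (polynomialRawRing n)
      renaming (_∙_ to _∙ᴾ_; _⁻¹ to _⁻¹ᴾ; ε to εᴾ; ⁅_,_⁆ to ⁅_,_⁆ᴾ; kernel to kernelᴾ; central to centralᴾ)
    open Symbolic public

    v : ∀ m {n} → Polynomial (suc m ℕ.+ n)
    v m {n} = var (fromℕ m ↑ˡ n)

    X₀ : ∀ {n} → Quad (Polynomial (4 ℕ.+ n))
    X₀ = quad (v 0) (v 1) (v 2) (v 3)

    X₁ : ∀ {n} → Quad (Polynomial (8 ℕ.+ n))
    X₁ = quad (v 4) (v 5) (v 6) (v 7)

    X₂ : ∀ {n} → Quad (Polynomial (12 ℕ.+ n))
    X₂ = quad (v 8) (v 9) (v 10) (v 11)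

    infixr 5 _∷ᵛ_
    _∷ᵛ_ : ∀ {n} → Quad (Fin ℓ) → Vec (Fin ℓ) n → Vec (Fin ℓ) (4 ℕ.+ n)
    q ∷ᵛ ρ = α q ∷ β q ∷ γ q ∷ δ q ∷ ρ

    ⟦_⟧Q : ∀ {n} → Quad (Polynomial n) → Vec (Fin ℓ) n → Quad (Fin ℓ)
    ⟦ q ⟧Q ρ = quad (⟦ α q ⟧ ρ) (⟦ β q ⟧ ρ) (⟦ γ q ⟧ ρ) (⟦ δ q ⟧ ρ)

    normaliseQ : ∀ {n} → Quad (Polynomial n) → Quad (Normal n)
    normaliseQ q = quad (normalise (α q)) (normalise (β q)) (normalise (γ q)) (normalise (δ q))

    proveQ : ∀ {n} (p q : Quad (Polynomial n)) ρ → normaliseQ p ≡ normaliseQ q → ⟦ p ⟧Q ρ ≡ ⟦ q ⟧Q ρ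
    proveQ p q ρ eq = quad-≡ (proveN (α p) (α q) ρ (cong α eq)) (proveN (β p) (β q) ρ (cong β eq))
                             (proveN (γ p) (γ q) ρ (cong γ eq)) (proveN (δ p) (δ q) ρ (cong δ eq))

    ∙-assoc : ∀ p q r → (p ∙ q) ∙ r ≡ p ∙ (q ∙ r)
    ∙-assoc p q r = proveQ ((X₀ ∙ᴾ X₁) ∙ᴾ X₂) (X₀ ∙ᴾ (X₁ ∙ᴾ X₂)) (p ∷ᵛ q ∷ᵛ r ∷ᵛ []) refl

    ∙-identityˡ : ∀ q → ε ∙ q ≡ q
    ∙-identityˡ q = proveQ (εᴾ ∙ᴾ X₀) X₀ (q ∷ᵛ []) refl

    ∙-identityʳ : ∀ q → q ∙ ε ≡ q
    ∙-identityʳ q = proveQ (X₀ ∙ᴾ εᴾ) X₀ (q ∷ᵛ []) refl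

    ∙-inverseˡ : ∀ q → q ⁻¹ ∙ q ≡ ε
    ∙-inverseˡ q = proveQ (X₀ ⁻¹ᴾ ∙ᴾ X₀) εᴾ (q ∷ᵛ []) refl

    ∙-inverseʳ : ∀ q → q ∙ q ⁻¹ ≡ ε
    ∙-inverseʳ q = proveQ (X₀ ∙ᴾ X₀ ⁻¹ᴾ) εᴾ (q ∷ᵛ []) refl

    quadGroup : Group 0ℓ 0ℓ
    quadGroup = record
      { Carrier = Quad (Fin ℓ) ; _≈_ = _≡_ ; _∙_ = _∙_ ; ε = ε ; _⁻¹ = _⁻¹
      ; isGroup = record
        { isMonoid = record
          { isSemigroup = record
            { isMagma = record { isEquivalence = isEquivalence ; ∙-cong = cong₂ _∙_ }
            ; assoc = ∙-assoc }
          ; identity = ∙-identityˡ , ∙-identityʳ }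
        ; inverse = ∙-inverseˡ , ∙-inverseʳ
        ; ⁻¹-cong = cong _⁻¹ } }

module Matrix where

  open ZMod
  open Coordinates
  open import Algebra.Bundles using (CommutativeRing)
  import Algebra.Properties.Ring as RingProperties
  open import Data.Fin using (Fin; zero; suc; #_)
  open import Data.Integer using (+_)
  open import Data.Nat as ℕ using (ℕ; NonZero; z≤n; s≤s)
  open import Data.Product using (_×_; _,_; uncurry)
  open import Data.Vec using (Vec; []; _∷_; lookup; tabulate)
  open import Data.Vec.Properties using (tabulate-cong; tabulate∘lookup; lookup∘tabulate)
  open import Relation.Binary.PropositionalEquality hiding (J)

  open ≡-Reasoning

  lowerUnitriangular : {A : Set} (0# 1# : A) → A → A → A → A → A → A → Fin 4 → Fin 4 → A
  lowerUnitriangular {A} 0# 1# a b c d e f = entry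
    where
    entry : Fin 4 → Fin 4 → A
    entry zero zero = 1#
    entry (suc zero) zero = a
    entry (suc zero) (suc zero) = 1#
    entry (suc (suc zero)) zero = b
    entry (suc (suc zero)) (suc zero) = c
    entry (suc (suc zero)) (suc (suc zero)) = 1#
    entry (suc (suc (suc zero))) zero = d
    entry (suc (suc (suc zero))) (suc zero) = e
    entry (suc (suc (suc zero))) (suc (suc zero)) = f
    entry (suc (suc (suc zero))) (suc (suc (suc zero))) = 1#
    entry _ _ = 0#

  module _ {ℓ : ℕ} .{{_ : NonZero ℓ}} where

    open Solver {ℓ} using (Polynomial; Normal; normalise; con; _:+_; _:*_; _:-_; :-_; ⟦_⟧)
    open RingProperties (CommutativeRing.ring (+-*-commutativeRing {ℓ})) using (+-inverseˡ-unique)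

    F : Set
    F = Fin ℓ

    lower : F → F → F → F → F → F → Mat ℓ
    lower a b c d e f = mat (lowerUnitriangular 0F 1F a b c d e f)

    matrix : Quad F → Mat ℓ
    matrix q = lower (α q) (β q) (γ q) (δ q) (β q - α q * γ q) (- α q)

    coords : Mat ℓ → Quad F
    coords M = quad (M ! (# 1) ! (# 0)) (M ! (# 2) ! (# 0)) (M ! (# 2) ! (# 1)) (M ! (# 3) ! (# 0))

    mat-cong : ∀ {f g : Fin 4 → Fin 4 → F} → (∀ i j → f i j ≡ g i j) → mat f ≡ mat g
    mat-cong f≗g = tabulate-cong λ i → tabulate-cong (f≗g i)

    mat-! : ∀ M → mat (λ i j → M ! i ! j) ≡ M
    mat-! M = trans (tabulate-cong λ i → tabulate∘lookup (lookup M i)) (tabulate∘lookup M)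

    PMat : ℕ → Set
    PMat n = Fin 4 → Fin 4 → Polynomial n

    ⟦_⟧ᴹ : ∀ {n} → PMat n → Vec F n → Mat ℓ
    ⟦ P ⟧ᴹ ρ = mat λ i j → ⟦ P i j ⟧ ρ

    normaliseᴹ : ∀ {n} → PMat n → Vec (Vec (Normal n) 4) 4
    normaliseᴹ P = tabulate λ i → tabulate λ j → normalise (P i j)

    proveᴹ : ∀ {n} (P R : PMat n) ρ → normaliseᴹ P ≡ normaliseᴹ R → ⟦ P ⟧ᴹ ρ ≡ ⟦ R ⟧ᴹ ρ
    proveᴹ P R ρ eq = mat-cong λ i j → proveN (P i j) (R i j) ρ (begin
      normalise (P i j)                     ≡⟨ lookup-normaliseᴹ P i j ⟨
      lookup (lookup (normaliseᴹ P) i) j    ≡⟨ cong (λ N → lookup (lookup N i) j) eq ⟩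
      lookup (lookup (normaliseᴹ R) i) j    ≡⟨ lookup-normaliseᴹ R i j ⟩
      normalise (R i j)                     ∎)
      where
      lookup-normaliseᴹ : ∀ {n} (P : PMat n) i j → lookup (lookup (normaliseᴹ P) i) j ≡ normalise (P i j)
      lookup-normaliseᴹ P i j =
        trans (cong (λ row → lookup row j) (lookup∘tabulate (λ i → tabulate λ j → normalise (P i j)) i))
              (lookup∘tabulate (λ j → normalise (P i j)) j)

    _·ᴾ_ : ∀ {n} → PMat n → PMat n → PMat n
    (P ·ᴾ Q) i j = ((P i (# 0) :* Q (# 0) j) :+ (P i (# 1) :* Q (# 1) j))
                :+ ((P i (# 2) :* Q (# 2) j) :+ (P i (# 3) :* Q (# 3) j))

    transposeᴾ : ∀ {n} → PMat n → PMat n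
    transposeᴾ P i j = P j i

    Jᴾ : ∀ {n} → PMat n
    Jᴾ zero (suc (suc (suc zero))) = con (+ 1)
    Jᴾ (suc zero) (suc (suc zero)) = con (+ 1)
    Jᴾ (suc (suc zero)) (suc zero) = :- con (+ 1)
    Jᴾ (suc (suc (suc zero))) zero = :- con (+ 1)
    Jᴾ _ _ = con (+ 0)

    symplecticFormᴾ : ∀ {n} → PMat n → PMat n
    symplecticFormᴾ P = (transposeᴾ P ·ᴾ Jᴾ) ·ᴾ P

    matrixᴾ : ∀ {n} → Quad (Polynomial n) → PMat n
    matrixᴾ q = lowerUnitriangular (con (+ 0)) (con (+ 1))
                  (α q) (β q) (γ q) (δ q) (β q :- α q :* γ q) (:- α q)

    matrix-∙ : ∀ p q → matrix (p ∙ q) ≡ matrix p · matrix q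
    matrix-∙ p q = proveᴹ (matrixᴾ (X₀ ∙ᴾ X₁)) (matrixᴾ X₀ ·ᴾ matrixᴾ X₁) (p ∷ᵛ q ∷ᵛ []) refl

    matrix-ε : matrix ε ≡ I
    matrix-ε = proveᴹ (matrixᴾ εᴾ) (lowerUnitriangular 0ᴾ 1ᴾ 0ᴾ 0ᴾ 0ᴾ 0ᴾ 0ᴾ 0ᴾ) [] refl
      where
      0ᴾ 1ᴾ : Polynomial 0
      0ᴾ = con (+ 0)
      1ᴾ = con (+ 1)

    matrix-InSp4 : ∀ q → InSp4 (matrix q)
    matrix-InSp4 q = proveᴹ (symplecticFormᴾ (matrixᴾ X₀)) Jᴾ (q ∷ᵛ []) refl

    matrix-LowerUnitriangular : ∀ q → LowerUnitriangular (matrix q)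
    matrix-LowerUnitriangular q = above , diagonal
      where
      above : ∀ i j → i Data.Fin.< j → matrix q ! i ! j ≡ 0F
      above zero (suc zero) _ = refl
      above zero (suc (suc zero)) _ = refl
      above zero (suc (suc (suc zero))) _ = refl
      above (suc zero) (suc (suc zero)) _ = refl
      above (suc zero) (suc (suc (suc zero))) _ = refl
      above (suc (suc zero)) (suc (suc (suc zero))) _ = refl
      above zero zero ()
      above (suc _) zero ()
      above (suc zero) (suc zero) (s≤s ())
      above (suc (suc _)) (suc zero) (s≤s ())
      above (suc (suc zero)) (suc (suc zero)) (s≤s (s≤s ()))
      above (suc (suc (suc _))) (suc (suc zero)) (s≤s (s≤s ()))
      above (suc (suc (suc zero))) (suc (suc (suc zero))) (s≤s (s≤s (s≤s ())))
      diagonal : ∀ i → matrix q ! i ! i ≡ 1F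
      diagonal zero = refl
      diagonal (suc zero) = refl
      diagonal (suc (suc zero)) = refl
      diagonal (suc (suc (suc zero))) = refl

    matrix-InSbar : ∀ q → InSbar (matrix q)
    matrix-InSbar q = matrix-LowerUnitriangular q , matrix-InSp4 q

    lowerPart : Mat ℓ → Fin 4 → Fin 4 → F
    lowerPart M = lowerUnitriangular 0F 1F (M ! (# 1) ! (# 0)) (M ! (# 2) ! (# 0)) (M ! (# 2) ! (# 1))
                                           (M ! (# 3) ! (# 0)) (M ! (# 3) ! (# 1)) (M ! (# 3) ! (# 2))

    lower-! : ∀ M → LowerUnitriangular M → M ≡ mat (lowerPart M)
    lower-! M (above , diagonal) = trans (sym (mat-! M)) (mat-cong entry)
      where
      entry : ∀ i j → M ! i ! j ≡ lowerPart M i j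
      entry zero zero = diagonal zero
      entry zero (suc j) = above zero (suc j) (s≤s z≤n)
      entry (suc zero) zero = refl
      entry (suc zero) (suc zero) = diagonal (# 1)
      entry (suc zero) (suc (suc j)) = above (# 1) (suc (suc j)) (s≤s (s≤s z≤n))
      entry (suc (suc zero)) zero = refl
      entry (suc (suc zero)) (suc zero) = refl
      entry (suc (suc zero)) (suc (suc zero)) = diagonal (# 2)
      entry (suc (suc zero)) (suc (suc (suc j))) = above (# 2) (suc (suc (suc j))) (s≤s (s≤s (s≤s z≤n)))
      entry (suc (suc (suc zero))) zero = refl
      entry (suc (suc (suc zero))) (suc zero) = refl
      entry (suc (suc (suc zero))) (suc (suc zero)) = refl
      entry (suc (suc (suc zero))) (suc (suc (suc zero))) = diagonal (# 3)

    -- The (0,1) and (0,2) entries of Lᵀ J L are e - (b - a c) and f + a.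
    lower-InSp4 : ∀ a b c d e f → InSp4 (lower a b c d e f) → e ≡ b - a * c × f ≡ - a
    lower-InSp4 a b c d e f sp = x-y≡0⇒x≡y entry₀₁ , +-inverseˡ-unique f a entry₀₂
      where
      ρ : Vec F 6
      ρ = a ∷ b ∷ c ∷ d ∷ e ∷ f ∷ []
      Lᴾ : PMat 6
      Lᴾ = lowerUnitriangular (con (+ 0)) (con (+ 1)) (v 0) (v 1) (v 2) (v 3) (v 4) (v 5)
      sp₀₁ : ⟦ symplecticFormᴾ Lᴾ (# 0) (# 1) ⟧ ρ ≡ 0F
      sp₀₁ = cong (λ M → M ! (# 0) ! (# 1)) sp
      sp₀₂ : ⟦ symplecticFormᴾ Lᴾ (# 0) (# 2) ⟧ ρ ≡ 0F
      sp₀₂ = cong (λ M → M ! (# 0) ! (# 2)) sp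
      entry₀₁ : e - (b - a * c) ≡ 0F
      entry₀₁ = trans (sym (proveN (symplecticFormᴾ Lᴾ (# 0) (# 1)) (v 4 :- (v 1 :- v 0 :* v 2)) ρ refl)) sp₀₁
      entry₀₂ : f + a ≡ 0F
      entry₀₂ = trans (sym (proveN (symplecticFormᴾ Lᴾ (# 0) (# 2)) (v 5 :+ v 0) ρ refl)) sp₀₂

    InSbar⇒matrix-coords : ∀ {M} → InSbar M → matrix (coords M) ≡ M
    InSbar⇒matrix-coords {M} (lu , sp) = sym (trans (lower-! M lu)
      (uncurry (cong₂ (lower _ _ _ _)) (lower-InSp4 _ _ _ _ _ _ (subst InSp4 (lower-! M lu) sp))))

    matrix-injective : ∀ {p q} → matrix p ≡ matrix q → p ≡ q
    matrix-injective = cong coords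

module Subgroup where

  open ZMod
  open Coordinates
  open Matrix
  import Algebra.Properties.Group as GroupProperties
  open import Data.Bool using (T)
  open import Data.Fin using (Fin)
  open import Data.Integer using (+_)
  open import Data.Nat using (ℕ; NonZero; _<_)
  open import Data.Nat.Primality using (Prime)
  open import Data.Product using (Σ; _×_; _,_; proj₁; proj₂)
  open import Data.Vec using ([]; _∷_)
  open import Function using (_∘_)
  open import Relation.Binary.PropositionalEquality hiding (J)

  open ≡-Reasoning

  module _ {ℓ : ℕ} .{{_ : NonZero ℓ}} where

    open Solver {ℓ} using (Polynomial; con; _:+_; _:*_; _:-_; solve; _:=_)
    open GroupProperties (quadGroup {ℓ}) using (inverseʳ-unique)

    infix 4 _∈_
    _∈_ : Quad (Fin ℓ) → Subset ℓ → Set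
    q ∈ K = T (K (matrix q))

    kernel-∙ : ∀ b d b′ d′ → kernel b d ∙ kernel b′ d′ ≡ kernel (b + b′) (d + d′)
    kernel-∙ b d b′ d′ = proveQ lhs rhs (b ∷ d ∷ b′ ∷ d′ ∷ []) refl
      where
      lhs rhs : Quad (Polynomial 4)
      lhs = kernelᴾ (v 0) (v 1) ∙ᴾ kernelᴾ (v 2) (v 3)
      rhs = kernelᴾ (v 0 :+ v 2) (v 1 :+ v 3)

    ∙-kernel-shift : ∀ a β c δ b d → quad a β c δ ∙ kernel (b - β) ((d - δ) + a * (b - β)) ≡ quad a b c d
    ∙-kernel-shift a β c δ b d = proveQ lhs rhs (quad a β c δ ∷ᵛ b ∷ d ∷ []) refl
      where
      lhs rhs : Quad (Polynomial 6)
      lhs = X₀ ∙ᴾ kernelᴾ (v 4 :- v 1) ((v 5 :- v 3) :+ v 0 :* (v 4 :- v 1))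
      rhs = quad (v 0) (v 4) (v 2) (v 5)

    commutator-kernel : ∀ b d q → ⁅ kernel b d , q ⁆ ≡ central (2F * (α q * b))
    commutator-kernel b d q = proveQ lhs rhs (q ∷ᵛ b ∷ d ∷ []) refl
      where
      lhs rhs : Quad (Polynomial 6)
      lhs = ⁅ kernelᴾ (v 4) (v 5) , X₀ ⁆ᴾ
      rhs = centralᴾ ((con (+ 1) :+ con (+ 1)) :* (v 0 :* v 4))

    commutator≡kernel : ∀ p q → ⁅ p , q ⁆ ≡ kernel (γ p * α q - γ q * α p) (δ ⁅ p , q ⁆)
    commutator≡kernel p q = proveQ lhs rhs (p ∷ᵛ q ∷ᵛ []) refl
      where
      lhs rhs : Quad (Polynomial 8)
      lhs = ⁅ X₀ , X₁ ⁆ᴾ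
      rhs = kernelᴾ (v 2 :* v 4 :- v 6 :* v 0) (δ lhs)

    commute⇒commutator≡ε : ∀ p q → p ∙ q ≡ q ∙ p → ⁅ p , q ⁆ ≡ ε
    commute⇒commutator≡ε p q pq≡qp = trans (cong ((q ∙ p) ⁻¹ ∙_) pq≡qp) (∙-inverseˡ (q ∙ p))

    α≡0⇒commute : ∀ p q → α p ≡ 0F → α q ≡ 0F → p ∙ q ≡ q ∙ p
    α≡0⇒commute p q αp≡0 αq≡0 = begin
      p ∙ q     ≡⟨ cong₂ _∙_ p≡ q≡ ⟩
      p₀ ∙ q₀   ≡⟨ proveQ lhs rhs (β p ∷ γ p ∷ δ p ∷ β q ∷ γ q ∷ δ q ∷ []) refl ⟩
      q₀ ∙ p₀   ≡⟨ cong₂ _∙_ q≡ p≡ ⟨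
      q ∙ p     ∎
      where
      p₀ q₀ : Quad (Fin ℓ)
      p₀ = quad 0F (β p) (γ p) (δ p)
      q₀ = quad 0F (β q) (γ q) (δ q)
      p≡ : p ≡ p₀
      p≡ = quad-≡ αp≡0 refl refl refl
      q≡ : q ≡ q₀
      q≡ = quad-≡ αq≡0 refl refl refl
      Y₀ Y₁ lhs rhs : Quad (Polynomial 6)
      Y₀ = quad (con (+ 0)) (v 0) (v 1) (v 2)
      Y₁ = quad (con (+ 0)) (v 3) (v 4) (v 5)
      lhs = Y₀ ∙ᴾ Y₁
      rhs = Y₁ ∙ᴾ Y₀

    module _ {K : Subset ℓ} (K-subgroup : IsSubgroup K) where

      private
        K⊆Sbar : ∀ M → T (K M) → InSbar M
        K⊆Sbar = proj₁ K-subgroup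
        I∈K : T (K I)
        I∈K = proj₁ (proj₂ K-subgroup)
        ·-closed : ∀ M N → T (K M) → T (K N) → T (K (M · N))
        ·-closed = proj₁ (proj₂ (proj₂ K-subgroup))
        inverse : ∀ M → T (K M) → Σ (Mat ℓ) λ N → T (K N) × (M · N ≡ I) × (N · M ≡ I)
        inverse = proj₂ (proj₂ (proj₂ K-subgroup))

      coords-∈ : ∀ {M} → T (K M) → coords M ∈ K
      coords-∈ {M} M∈K = subst (T ∘ K) (sym (InSbar⇒matrix-coords {M = M} (K⊆Sbar M M∈K))) M∈K

      ε-∈ : ε ∈ K
      ε-∈ = subst (T ∘ K) (sym matrix-ε) I∈K

      ∙-∈ : ∀ {p q} → p ∈ K → q ∈ K → p ∙ q ∈ K
      ∙-∈ {p} {q} p∈K q∈K = subst (T ∘ K) (sym (matrix-∙ p q)) (·-closed _ _ p∈K q∈K)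

      ⁻¹-∈ : ∀ {q} → q ∈ K → q ⁻¹ ∈ K
      ⁻¹-∈ {q} q∈K = from-inverse (inverse (matrix q) q∈K)
        where
        from-inverse : (Σ (Mat ℓ) λ N → T (K N) × (matrix q · N ≡ I) × (N · matrix q ≡ I)) → q ⁻¹ ∈ K
        from-inverse (N , N∈K , q·N≡I , _) = subst (_∈ K) N≡q⁻¹ (coords-∈ N∈K)
          where
          N≡q⁻¹ : coords N ≡ q ⁻¹
          N≡q⁻¹ = inverseʳ-unique q (coords N) (matrix-injective (begin
            matrix (q ∙ coords N)          ≡⟨ matrix-∙ q (coords N) ⟩
            matrix q · matrix (coords N)   ≡⟨ cong (matrix q ·_) (InSbar⇒matrix-coords {M = N} (K⊆Sbar N N∈K)) ⟩
            matrix q · N                   ≡⟨ q·N≡I ⟩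
            I                              ≡⟨ matrix-ε ⟨
            matrix ε                       ∎))

      commutator-∈ : ∀ {p q} → p ∈ K → q ∈ K → ⁅ p , q ⁆ ∈ K
      commutator-∈ p∈K q∈K = ∙-∈ (⁻¹-∈ (∙-∈ q∈K p∈K)) (∙-∈ p∈K q∈K)

      kernel-scalar : ∀ {b d} → kernel b d ∈ K → ∀ s → kernel (s * b) (s * d) ∈ K
      kernel-scalar = +-closed⇒scalar-closed (λ b d → kernel b d ∈ K) ε-∈
        λ {b} {d} {b′} {d′} p∈K q∈K → subst (_∈ K) (kernel-∙ b d b′ d′) (∙-∈ p∈K q∈K)

      InImage : Fin ℓ → Fin ℓ → Set
      InImage a c = Σ (Fin ℓ) λ b → Σ (Fin ℓ) λ d → quad a b c d ∈ K

      image-scalar : ∀ {a c} → InImage a c → ∀ s → InImage (s * a) (s * c)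
      image-scalar = +-closed⇒scalar-closed InImage (0F , 0F , ε-∈)
        λ (_ , _ , p∈K) (_ , _ , q∈K) → _ , _ , ∙-∈ p∈K q∈K

      fibre⊆ : (∀ b d → kernel b d ∈ K) → ∀ {a β c δ} → quad a β c δ ∈ K → ∀ b d → quad a b c d ∈ K
      fibre⊆ kernel⊆K {a} {β} {c} {δ} q∈K b d =
        subst (_∈ K) (∙-kernel-shift a β c δ b d) (∙-∈ q∈K (kernel⊆K _ _))

      line⊆ : (∀ b d → kernel b d ∈ K) → ∀ {k} → InImage 1F k → ∀ a b d → quad a b (k * a) d ∈ K
      line⊆ kernel⊆K {k} (_ , _ , q∈K) a b d =
        subst (_∈ K) (cong₂ (λ a′ c′ → quad a′ b c′ d) (*-identityʳ a) (*-comm a k))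
          (fibre⊆ kernel⊆K (proj₂ (proj₂ (image-scalar (_ , _ , q∈K) a))) b d)

      module _ (ℓ-prime : Prime ℓ) where

        central⊆ : ∀ {e} → central e ∈ K → e ≢ 0F → ∀ d → central d ∈ K
        central⊆ {e} e∈K e≢0 d = scale (*F-divide ℓ-prime e≢0 d)
          where
          scale : Σ (Fin ℓ) (λ s → s * e ≡ d) → central d ∈ K
          scale (s , s*e≡d) = subst (_∈ K) (cong₂ kernel (zeroʳ s) s*e≡d) (kernel-scalar e∈K s)

        kernel⊆ : (∀ d → central d ∈ K) → ∀ {b₀ d₀} → kernel b₀ d₀ ∈ K → b₀ ≢ 0F → ∀ b d → kernel b d ∈ K
        kernel⊆ central⊆K {b₀} {d₀} k∈K b₀≢0 b d = scale (*F-divide ℓ-prime b₀≢0 b)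
          where
          scale : Σ (Fin ℓ) (λ s → s * b₀ ≡ b) → kernel b d ∈ K
          scale (s , s*b₀≡b) = subst (_∈ K) k≡ (∙-∈ (kernel-scalar k∈K s) (central⊆K (d - s * d₀)))
            where
            k≡ : kernel (s * b₀) (s * d₀) ∙ central (d - s * d₀) ≡ kernel b d
            k≡ = trans (kernel-∙ (s * b₀) (s * d₀) 0F (d - s * d₀))
              (cong₂ kernel (trans (+-identityʳ (s * b₀)) s*b₀≡b)
                            (solve 2 (λ u d → u :+ (d :- u) := d) refl (s * d₀) d))

        -- The commutator with an element outside the kernel turns a kernel element
        -- with b₀ ≠ 0 into a nonzero central element; this is where ℓ ≠ 2 is needed.
        kernel⊆-from-commutator : 2 < ℓ → ∀ {q b₀ d₀} → q ∈ K → α q ≢ 0F → kernel b₀ d₀ ∈ K → b₀ ≢ 0F →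
          ∀ b d → kernel b d ∈ K
        kernel⊆-from-commutator 2<ℓ {q} {b₀} {d₀} q∈K αq≢0 k∈K b₀≢0 =
          kernel⊆ (central⊆ central∈K 2αb₀≢0) k∈K b₀≢0
          where
          central∈K : central (2F * (α q * b₀)) ∈ K
          central∈K = subst (_∈ K) (commutator-kernel b₀ d₀ q) (commutator-∈ k∈K q∈K)
          2αb₀≢0 : 2F * (α q * b₀) ≢ 0F
          2αb₀≢0 = *F-≢0F ℓ-prime (2F≢0F 2<ℓ) (*F-≢0F ℓ-prime αq≢0 b₀≢0)

module Family where

  open Finite
  open ZMod
  open Coordinates
  open Matrix
  open Subgroup
  open import Data.Bool using (T)
  open import Data.Fin as Fin using (Fin; toℕ)
  open import Data.Integer using (+_)
  open import Data.Nat as ℕ using (ℕ; zero; suc; NonZero; _<_; _^_)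
  open import Data.Nat.DivMod using (_mod_)
  open import Data.Nat.Primality using (Prime)
  import Data.Nat.Properties as ℕP
  open import Data.Product using (Σ; _×_; _,_; proj₁; proj₂)
  open import Data.Vec using ([]; _∷_)
  open import Data.Vec.Properties using (≡-dec)
  open import Function using (_∘_)
  open import Function.Bundles using (_↔_; mk↔ₛ′)
  open import Function.Properties.Inverse using (↔-sym; ↔-trans)
  open import Relation.Binary.Definitions using (DecidableEquality)
  open import Relation.Binary.PropositionalEquality hiding (J)
  open import Relation.Nullary using (_×-dec_)
  open import Relation.Nullary.Decidable using (isYes; toWitness; fromWitness)
  open import Relation.Unary using (Decidable)

  open ≡-Reasoning

  module _ {ℓ : ℕ} .{{_ : NonZero ℓ}} where

    open Solver {ℓ} using (Polynomial; con; _:+_; _:*_; _:-_; :-_; solve; _:=_)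

    _≟ᴹ_ : DecidableEquality (Mat ℓ)
    _≟ᴹ_ = ≡-dec (≡-dec Fin._≟_)

    matrices : {P : Quad F → Set} → Decidable P → Subset ℓ
    matrices P? M = isYes ((M ≟ᴹ matrix (coords M)) ×-dec P? (coords M))

    module _ {P : Quad F → Set} (P? : Decidable P) where

      matrices-intro : ∀ {q} → P q → q ∈ matrices P?
      matrices-intro Pq = fromWitness (refl , Pq)

      matrices-elim : ∀ {M} → T (matrices P? M) → M ≡ matrix (coords M) × P (coords M)
      matrices-elim = toWitness

      matrices-subgroup : P ε → (∀ {p q} → P p → P q → P (p ∙ q)) → (∀ {q} → P q → P (q ⁻¹)) →
        IsSubgroup (matrices P?)
      matrices-subgroup Pε P-∙ P-⁻¹ = ⊆Sbar , I∈ , ·-closed , inverse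
        where
        ∙≡ε⇒·≡I : ∀ {p q} → p ∙ q ≡ ε → matrix p · matrix q ≡ I
        ∙≡ε⇒·≡I {p} {q} pq≡ε = trans (sym (matrix-∙ p q)) (trans (cong matrix pq≡ε) matrix-ε)
        ⊆Sbar : ∀ M → T (matrices P? M) → InSbar M
        ⊆Sbar M M∈ = subst InSbar (sym (proj₁ (matrices-elim M∈))) (matrix-InSbar (coords M))
        I∈ : T (matrices P? I)
        I∈ = subst (T ∘ matrices P?) matrix-ε (matrices-intro Pε)
        ·-closed : ∀ M N → T (matrices P? M) → T (matrices P? N) → T (matrices P? (M · N))
        ·-closed M N M∈ N∈ = subst (T ∘ matrices P?) M·N≡
          (matrices-intro (P-∙ (proj₂ (matrices-elim M∈)) (proj₂ (matrices-elim N∈))))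
          where
          M·N≡ : matrix (coords M ∙ coords N) ≡ M · N
          M·N≡ = trans (matrix-∙ (coords M) (coords N))
            (sym (cong₂ _·_ (proj₁ (matrices-elim M∈)) (proj₁ (matrices-elim N∈))))
        inverse : ∀ M → T (matrices P? M) → Σ (Mat ℓ) λ N → T (matrices P? N) × (M · N ≡ I) × (N · M ≡ I)
        inverse M M∈ = matrix (coords M ⁻¹) , matrices-intro (P-⁻¹ (proj₂ (matrices-elim M∈))) ,
          subst (λ M′ → M′ · matrix (coords M ⁻¹) ≡ I) M≡ (∙≡ε⇒·≡I (∙-inverseʳ (coords M))) ,
          subst (λ M′ → matrix (coords M ⁻¹) · M′ ≡ I) M≡ (∙≡ε⇒·≡I (∙-inverseˡ (coords M)))
          where
          M≡ : matrix (coords M) ≡ M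
          M≡ = sym (proj₁ (matrices-elim M∈))

    OnLine : F → Quad F → Set
    OnLine k q = γ q ≡ k * α q

    OnLine? : ∀ k → Decidable (OnLine k)
    OnLine? k q = γ q Fin.≟ k * α q

    G : F → Subset ℓ
    G k = matrices (OnLine? k)

    G-subgroup : ∀ k → IsSubgroup (G k)
    G-subgroup k = matrices-subgroup (OnLine? k) (sym (zeroʳ k))
      (λ {p} {q} → ∙-closed {p} {q}) (λ {q} → ⁻¹-closed {q})
      where
      ∙-closed : ∀ {p q} → OnLine k p → OnLine k q → OnLine k (p ∙ q)
      ∙-closed {p} {q} p∈ q∈ = trans (cong₂ _+_ p∈ q∈) (sym (distribˡ k (α p) (α q)))
      ⁻¹-closed : ∀ {q} → OnLine k q → OnLine k (q ⁻¹)
      ⁻¹-closed {q} q∈ = trans (cong -_ q∈) (solve 2 (λ k a → :- (k :* a) := k :* (:- a)) refl k (α q))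

    G-intro : ∀ k q → OnLine k q → q ∈ G k
    G-intro k q = matrices-intro (OnLine? k) {q}

    toLine : F → Quad F → Quad F
    toLine k q = quad (α q) (β q) (k * α q) (δ q)

    G-elim : ∀ {k M} → T (G k M) → M ≡ matrix (toLine k (coords M))
    G-elim {k} {M} M∈G = trans (proj₁ M∈G′) (cong matrix (quad-≡ refl refl (proj₂ M∈G′) refl))
      where
      M∈G′ : M ≡ matrix (coords M) × OnLine k (coords M)
      M∈G′ = matrices-elim (OnLine? k) M∈G

    line⊆⇒G⊆ : ∀ {k} {K : Subset ℓ} → (∀ a b d → quad a b (k * a) d ∈ K) → ∀ M → T (G k M) → T (K M)
    line⊆⇒G⊆ {k} {K} line⊆K M M∈G = subst (T ∘ K) (sym (G-elim {k} M∈G)) (line⊆K _ _ _)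

    G↔ : ∀ k → Elements (G k) ↔ (F × F × F)
    G↔ k = mk↔ₛ′ to from (λ _ → refl) from∘to
      where
      to : Elements (G k) → F × F × F
      to (M , _) = α (coords M) , β (coords M) , δ (coords M)
      from : F × F × F → Elements (G k)
      from (a , b , d) = matrix (quad a b (k * a) d) , G-intro k (quad a b (k * a) d) refl
      from∘to : ∀ M → from (to M) ≡ M
      from∘to (M , M∈G) = element-≡ (sym (G-elim {k} M∈G))

    G-order : ∀ k → HasOrder (G k) (ℓ ^ 3)
    G-order k = ↔-trans (Fin-^3↔ ℓ) (↔-sym (G↔ k))

    lower≡matrix : ∀ {a b c d e f} → e ≡ b - a * c → f ≡ - a → lower a b c d e f ≡ matrix (quad a b c d)
    lower≡matrix = cong₂ (lower _ _ _ _)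

    x₁≡ : x₁ ≡ matrix (quad 1F 0F 0F 0F)
    x₁≡ = lower≡matrix (proveN (con (+ 0)) (con (+ 0) :- con (+ 1) :* con (+ 0)) [] refl) refl

    γ-axis : F → Quad F
    γ-axis c = quad 0F 0F c 0F

    x₂≡ : x₂ ≡ matrix (γ-axis 1F)
    x₂≡ = lower≡matrix (proveN (con (+ 0)) (con (+ 0) :- con (+ 0) :* con (+ 1)) [] refl)
                       (proveN (con (+ 0)) (:- con (+ 0)) [] refl)

    x₃≡ : x₃ ≡ matrix (kernel 1F 0F)
    x₃≡ = lower≡matrix (proveN (con (+ 1)) (con (+ 1) :- con (+ 0) :* con (+ 0)) [] refl)
                       (proveN (con (+ 0)) (:- con (+ 0)) [] refl)

    γ-axis-∙ : ∀ c c′ → γ-axis c ∙ γ-axis c′ ≡ γ-axis (c + c′)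
    γ-axis-∙ c c′ = proveQ lhs rhs (c ∷ c′ ∷ []) refl
      where
      γ-axisᴾ : Polynomial 2 → Quad (Polynomial 2)
      γ-axisᴾ c = quad (con (+ 0)) (con (+ 0)) c (con (+ 0))
      lhs rhs : Quad (Polynomial 2)
      lhs = γ-axisᴾ (v 0) ∙ᴾ γ-axisᴾ (v 1)
      rhs = γ-axisᴾ (v 0 :+ v 1)

    x₂^≡ : ∀ n → x₂ ^ᴹ n ≡ matrix (γ-axis (n mod ℓ))
    x₂^≡ zero = sym matrix-ε
    x₂^≡ (suc n) = begin
      x₂ · (x₂ ^ᴹ n)                                   ≡⟨ cong₂ _·_ x₂≡ (x₂^≡ n) ⟩
      matrix (γ-axis 1F) · matrix (γ-axis (n mod ℓ))   ≡⟨ matrix-∙ _ _ ⟨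
      matrix (γ-axis 1F ∙ γ-axis (n mod ℓ))            ≡⟨ cong matrix (γ-axis-∙ 1F (n mod ℓ)) ⟩
      matrix (γ-axis (1F + (n mod ℓ)))                 ≡⟨ cong (matrix ∘ γ-axis) (mod-+ 1 n) ⟨
      matrix (γ-axis (suc n mod ℓ))                    ∎

    y : F → Quad F
    y k = quad 1F 0F k 0F

    x₁x₂^≡ : ∀ k → x₁ · (x₂ ^ᴹ toℕ k) ≡ matrix (y k)
    x₁x₂^≡ k = begin
      x₁ · (x₂ ^ᴹ toℕ k)                            ≡⟨ cong₂ _·_ x₁≡ (x₂^≡ (toℕ k)) ⟩
      matrix x₁ᵠ · matrix (γ-axis (toℕ k mod ℓ))    ≡⟨ cong (λ c → matrix x₁ᵠ · matrix (γ-axis c)) (mod-toℕ k) ⟩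
      matrix x₁ᵠ · matrix (γ-axis k)                ≡⟨ matrix-∙ _ _ ⟨
      matrix (x₁ᵠ ∙ γ-axis k)                       ≡⟨ cong matrix (proveQ lhs rhs (k ∷ []) refl) ⟩
      matrix (y k)                                  ∎
      where
      x₁ᵠ : Quad F
      x₁ᵠ = quad 1F 0F 0F 0F
      lhs rhs : Quad (Polynomial 1)
      lhs = quad (con (+ 1)) (con (+ 0)) (con (+ 0)) (con (+ 0)) ∙ᴾ quad (con (+ 0)) (con (+ 0)) (v 0) (con (+ 0))
      rhs = quad (con (+ 1)) (con (+ 0)) (v 0) (con (+ 0))

    y∈G : ∀ k → y k ∈ G k
    y∈G k = G-intro k (y k) (sym (*-identityʳ k))

    x₃∈G : ∀ k → kernel 1F 0F ∈ G k
    x₃∈G k = G-intro k (kernel 1F 0F) (sym (zeroʳ k))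

    G-injective : ∀ k k′ → G k ≐ G k′ → k ≡ k′
    G-injective k k′ G≐ = trans (proj₂ (matrices-elim (OnLine? k′) y∈G′)) (*-identityʳ k′)
      where
      y∈G′ : y k ∈ G k′
      y∈G′ = subst T (G≐ (matrix (y k))) (y∈G k)

    module _ (ℓ-prime : Prime ℓ) (2<ℓ : 2 < ℓ) where

      private
        1≢0 : 1F ≢ 0F
        1≢0 = 1F≢0F (ℕP.<-trans (ℕP.n<1+n 1) 2<ℓ)

      G-nonabelian : ∀ k → Nonabelian (G k)
      G-nonabelian k abelian = 2≢0 (cong δ commutator≡ε)
        where
        commute : kernel 1F 0F ∙ y k ≡ y k ∙ kernel 1F 0F
        commute = matrix-injective (begin
          matrix (kernel 1F 0F ∙ y k)              ≡⟨ matrix-∙ _ _ ⟩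
          matrix (kernel 1F 0F) · matrix (y k)     ≡⟨ abelian _ _ (x₃∈G k) (y∈G k) ⟩
          matrix (y k) · matrix (kernel 1F 0F)     ≡⟨ matrix-∙ _ _ ⟨
          matrix (y k ∙ kernel 1F 0F)              ∎)
        commutator≡ε : central (2F * (1F * 1F)) ≡ ε
        commutator≡ε = trans (sym (commutator-kernel 1F 0F (y k)))
                             (commute⇒commutator≡ε (kernel 1F 0F) (y k) commute)
        2≢0 : 2F * (1F * 1F) ≢ 0F
        2≢0 = *F-≢0F ℓ-prime (2F≢0F 2<ℓ) (*F-≢0F ℓ-prime 1≢0 1≢0)

      G-generated : ∀ k → IsGeneratedBy (G k) (x₁ · (x₂ ^ᴹ toℕ k)) x₃
      G-generated k = G-subgroup k , subst (T ∘ G k) (sym (x₁x₂^≡ k)) (y∈G k) ,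
                      subst (T ∘ G k) (sym x₃≡) (x₃∈G k) , minimal
        where
        minimal : ∀ K → IsSubgroup K → T (K (x₁ · (x₂ ^ᴹ toℕ k))) → T (K x₃) → ∀ M → T (G k M) → T (K M)
        minimal K K≤ y∈K x₃∈K = line⊆⇒G⊆ {k} (line⊆ K≤ kernel⊆K (0F , 0F , y′∈K))
          where
          y′∈K : y k ∈ K
          y′∈K = subst (T ∘ K) (x₁x₂^≡ k) y∈K
          x₃′∈K : kernel 1F 0F ∈ K
          x₃′∈K = subst (T ∘ K) x₃≡ x₃∈K
          kernel⊆K : ∀ b d → kernel b d ∈ K
          kernel⊆K = kernel⊆-from-commutator K≤ ℓ-prime 2<ℓ y′∈K 1≢0 x₃′∈K 1≢0

module Classification where

  open Finite
  open ZMod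
  open Coordinates
  open Matrix
  open Subgroup
  open Family
  open import Data.Bool using (T)
  open import Data.Empty using (⊥-elim)
  open import Data.Fin as Fin using (Fin)
  open import Data.Nat using (ℕ; NonZero; _<_; _^_)
  open import Data.Nat.Primality using (Prime)
  open import Data.Product using (Σ; _×_; _,_; proj₁)
  open import Data.Sum using (_⊎_; inj₁; inj₂; [_,_]′)
  open import Function using (_∘_; id)
  open import Relation.Binary.PropositionalEquality hiding (J)
  open import Relation.Nullary using (¬_)

  open ≡-Reasoning

  module _ {ℓ : ℕ} .{{_ : NonZero ℓ}} where

    open Solver {ℓ} using (_:+_; _:*_; _:-_; solve; _:=_)

    α≡0⇒abelian : ∀ {H} → IsSubgroup H → (∀ M → T (H M) → α (coords M) ≡ 0F) → IsAbelian H
    α≡0⇒abelian H≤ α≡0 M N M∈H N∈H = begin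
      M · N                                   ≡⟨ cong₂ _·_ M≡ N≡ ⟨
      matrix (coords M) · matrix (coords N)   ≡⟨ matrix-∙ (coords M) (coords N) ⟨
      matrix (coords M ∙ coords N)            ≡⟨ cong matrix M∙N≡N∙M ⟩
      matrix (coords N ∙ coords M)            ≡⟨ matrix-∙ (coords N) (coords M) ⟩
      matrix (coords N) · matrix (coords M)   ≡⟨ cong₂ _·_ N≡ M≡ ⟩
      N · M                                   ∎
      where
      M∙N≡N∙M : coords M ∙ coords N ≡ coords N ∙ coords M
      M∙N≡N∙M = α≡0⇒commute (coords M) (coords N) (α≡0 M M∈H) (α≡0 N N∈H)
      M≡ : matrix (coords M) ≡ M
      M≡ = InSbar⇒matrix-coords {M = M} (proj₁ H≤ M M∈H)
      N≡ : matrix (coords N) ≡ N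
      N≡ = InSbar⇒matrix-coords {M = N} (proj₁ H≤ N N∈H)

    module _ (ℓ-prime : Prime ℓ) (2<ℓ : 2 < ℓ) {K : Subset ℓ} (K≤ : IsSubgroup K) where

      -- K contains q₀ on the line γ = k α (with α q₀ ≠ 0) and q off it: their commutator is a
      -- kernel element with b-coordinate (γ q - k α q) α q₀ ≠ 0, so K contains the whole kernel,
      -- and a scalar multiple of the image of q₀ is (1, k).
      line⊆-from-offLine : ∀ {k q₀ q} → q₀ ∈ K → α q₀ ≢ 0F → OnLine k q₀ → q ∈ K → ¬ OnLine k q →
        ∀ a b d → quad a b (k * a) d ∈ K
      line⊆-from-offLine {k} {q₀} {q} q₀∈K α₀≢0 q₀-on q∈K q-off = line⊆ K≤ kernel⊆K image-1k
        where
        b≡ : γ q * α q₀ - γ q₀ * α q ≡ (γ q - k * α q) * α q₀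
        b≡ = begin
          γ q * α q₀ - γ q₀ * α q          ≡⟨ cong (λ c₀ → γ q * α q₀ - c₀ * α q) q₀-on ⟩
          γ q * α q₀ - (k * α q₀) * α q    ≡⟨ solve 4 (λ c a₀ k a → c :* a₀ :- (k :* a₀) :* a := (c :- k :* a) :* a₀)
                                                refl (γ q) (α q₀) k (α q) ⟩
          (γ q - k * α q) * α q₀           ∎
        b≢0 : γ q * α q₀ - γ q₀ * α q ≢ 0F
        b≢0 b≡0 = *F-≢0F ℓ-prime (q-off ∘ x-y≡0⇒x≡y) α₀≢0 (trans (sym b≡) b≡0)
        commutator∈K : kernel (γ q * α q₀ - γ q₀ * α q) (δ ⁅ q , q₀ ⁆) ∈ K
        commutator∈K = subst (_∈ K) (commutator≡kernel q q₀) (commutator-∈ K≤ q∈K q₀∈K)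
        kernel⊆K : ∀ b d → kernel b d ∈ K
        kernel⊆K = kernel⊆-from-commutator K≤ ℓ-prime 2<ℓ q₀∈K α₀≢0 commutator∈K b≢0
        image-1k : InImage K≤ 1F k
        image-1k = rescale (*F-divide ℓ-prime α₀≢0 1F)
          where
          rescale : Σ F (λ s → s * α q₀ ≡ 1F) → InImage K≤ 1F k
          rescale (s , sα₀≡1) = subst₂ (InImage K≤) sα₀≡1 sγ₀≡k (image-scalar K≤ (β q₀ , δ q₀ , q₀∈K) s)
            where
            sγ₀≡k : s * γ q₀ ≡ k
            sγ₀≡k = begin
              s * γ q₀          ≡⟨ cong (s *_) q₀-on ⟩
              s * (k * α q₀)    ≡⟨ solve 3 (λ s k a → s :* (k :* a) := k :* (s :* a)) refl s k (α q₀) ⟩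
              k * (s * α q₀)    ≡⟨ cong (k *_) sα₀≡1 ⟩
              k * 1F            ≡⟨ *-identityʳ k ⟩
              k                 ∎

    module _ (ℓ-prime : Prime ℓ) (2<ℓ : 2 < ℓ) {H : Subset ℓ} (H≤ : IsSubgroup H) (H↔ : HasOrder H (ℓ ^ 3)) where

      ≐G-of-onLine : ∀ {h₀ k} → T (H h₀) → α (coords h₀) ≢ 0F → OnLine k (coords h₀) → H ≐ G k
      ≐G-of-onLine {h₀} {k} h₀∈H α₀≢0 h₀-on M = T-injective (H⊆G M) (G⊆H M)
        where
        off-line⇒G⊆H : (Σ (Mat ℓ) λ M → T (H M) × ¬ OnLine k (coords M)) → ∀ M → T (G k M) → T (H M)
        off-line⇒G⊆H (M , M∈H , M-off) = line⊆⇒G⊆ {k = k}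
          (line⊆-from-offLine ℓ-prime 2<ℓ H≤ {k = k} (coords-∈ H≤ h₀∈H) α₀≢0 h₀-on (coords-∈ H≤ M∈H) M-off)
        on-line⇒H⊆G : (∀ M → T (H M) → OnLine k (coords M)) → ∀ M → T (H M) → T (G k M)
        on-line⇒H⊆G all-on M M∈H = subst (T ∘ G k) (InSbar⇒matrix-coords {M = M} (proj₁ H≤ M M∈H))
          (G-intro k (coords M) (all-on M M∈H))
        H⊆G⊎G⊆H : (∀ M → T (H M) → T (G k M)) ⊎ (∀ M → T (G k M) → T (H M))
        H⊆G⊎G⊆H = [ inj₂ ∘ off-line⇒G⊆H , inj₁ ∘ on-line⇒H⊆G ]′
          (all-or-counterexample (OnLine k ∘ coords) (OnLine? k ∘ coords) H↔)
        H⊆G : ∀ M → T (H M) → T (G k M)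
        H⊆G = [ id , ⊆-of-equal-size⇒⊇ (G-order k) H↔ ]′ H⊆G⊎G⊆H
        G⊆H : ∀ M → T (G k M) → T (H M)
        G⊆H = [ ⊆-of-equal-size⇒⊇ H↔ (G-order k) , id ]′ H⊆G⊎G⊆H

      ≐G-of-α≢0 : ∀ {h₀} → T (H h₀) → α (coords h₀) ≢ 0F → Σ F λ k → H ≐ G k
      ≐G-of-α≢0 {h₀} h₀∈H α₀≢0 = slope (*F-divide ℓ-prime α₀≢0 (γ (coords h₀)))
        where
        slope : Σ F (λ k → k * α (coords h₀) ≡ γ (coords h₀)) → Σ F λ k → H ≐ G k
        slope (k , kα₀≡γ₀) = k , ≐G-of-onLine {k = k} h₀∈H α₀≢0 (sym kα₀≡γ₀)

      classification : Nonabelian H → Σ F λ k → H ≐ G k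
      classification nonabelian =
        [ (λ (h₀ , h₀∈H , α₀≢0) → ≐G-of-α≢0 h₀∈H α₀≢0)
        , (λ all-α≡0 → ⊥-elim (nonabelian (α≡0⇒abelian H≤ all-α≡0))) ]′
        (all-or-counterexample (λ M → α (coords M) ≡ 0F) (λ M → α (coords M) Fin.≟ 0F) H↔)

open ZMod using (odd-prime⇒2<)
open Family using (G; G-generated; G-subgroup; G-order; G-nonabelian; G-injective)
open Classification using (classification)

lemma3p2 : (ℓ : ℕ) .{{_ : NonZero ℓ}} → Prime ℓ → ¬ (2 ∣ ℓ) →
  Σ (Fin ℓ → Subset ℓ) λ G →
    (∀ k → IsGeneratedBy (G k) (x₁ · (x₂ ^ᴹ toℕ k)) x₃) ×
    (∀ k → IsSubgroup (G k) × HasOrder (G k) (ℓ ^ 3) × Nonabelian (G k)) ×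
    (∀ k k′ → G k ≐ G k′ → k ≡ k′) ×
    (∀ H → IsSubgroup H → HasOrder H (ℓ ^ 3) → Nonabelian H →
      Σ (Fin ℓ) λ k → H ≐ G k)
lemma3p2 ℓ ℓ-prime 2∤ℓ =
  G , G-generated ℓ-prime 2<ℓ , (λ k → G-subgroup k , G-order k , G-nonabelian ℓ-prime 2<ℓ k) , G-injective ,
  λ H H≤ H↔ → classification ℓ-prime 2<ℓ H≤ H↔
  where
  2<ℓ : 2 < ℓ
  2<ℓ = odd-prime⇒2< ℓ-prime 2∤ℓ
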